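{- Let $f,g:\subseteq\mathbb{N}^\mathbb{N}\rightrightarrows\mathbb{N}^\mathbb{N}$ with $\mathrm{dom}(g)\neq\emptyset$. Then $f/g\times g\le_W f$, and for every problem $h$ with $h\times g\le_W f$ we have $h\le_W f/g$; that is, $f/g\equiv_W\max_{\le_W}\{h: h\times g\le_W f\}$.
   Context: $(\Phi_e)_{e\in\mathbb{N}}$ is a standard enumeration of Turing functionals. The parallel quotient $f/g:\subseteq\mathbb{N}\times\mathbb{N}\times\mathbb{N}^\mathbb{N}\rightrightarrows\mathbb{N}^\mathbb{N}$ has domain the set of $(e,i,p)$ such that for all $q\in\mathrm{dom}(g)$: $\Phi_e(p,q)\in\mathrm{dom}(f)$ and for all $r\in f(\Phi_e(p,q))$, $\Phi_i(p,q,r)\in g(q)$; and $f/g(e,i,p)=\{\langle q,r\rangle: q\in\mathrm{dom}(g),\ r\in f(\Phi_e(p,q))\}$. $f\times g$: given an $f$-instance and a $g$-instance, output solutions of both. $\le_W$: Weihrauch reducibility. -}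

module Defs where

open import Data.Nat using (ℕ; zero; suc; _+_)
open import Data.Product using (Σ; ∃; _×_; _,_; proj₁; proj₂)
open import Data.Maybe.Base using (Maybe; just; nothing; _>>=_)
open import Relation.Binary.PropositionalEquality using (_≡_; _≗_)

Baire : Set
Baire = ℕ → ℕ

-- Cantor pairing on ℕ:  pair a b = (a+b)(a+b+1)/2 + a
tri : ℕ → ℕ
tri zero    = zero
tri (suc n) = tri n + suc n

pair : ℕ → ℕ → ℕ
pair a b = tri (a + b) + a

-- its inverse, by enumerating ℕ×ℕ along the Cantor diagonals
nextPair : ℕ × ℕ → ℕ × ℕ
nextPair (a , zero)  = (zero , suc a)
nextPair (a , suc b) = (suc a , b)

unpair : ℕ → ℕ × ℕ
unpair zero    = (zero , zero)
unpair (suc n) = nextPair (unpair n)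

fst snd : ℕ → ℕ
fst n = proj₁ (unpair n)
snd n = proj₂ (unpair n)

-- pairing of Baire sequences: ⟨p,q⟩(2n) = p(n), ⟨p,q⟩(2n+1) = q(n)
⟨_,_⟩ : Baire → Baire → Baire
⟨ p , q ⟩ zero    = p zero
⟨ p , q ⟩ (suc n) = ⟨ q , (λ m → p (suc m)) ⟩ n

left right : Baire → Baire
left  x n = x (n + n)
right x n = x (suc (n + n))

-- A standard enumeration of Turing functionals (oracle partial recursive
-- functions ℕ ⇀ ℕ relative to an oracle α, with codes in ℕ).
-- A code e is decoded as (tag , r) = unpair e:
--   0 : x ↦ 0          1 : x ↦ x+1        2 : x ↦ x
--   3 : x ↦ α x        4 : x ↦ fst x      5 : x ↦ snd x
--   6 : composition  x ↦ F (G x),                 F = fst r, G = snd r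
--   7 : pairing      x ↦ pair (F x) (G x)
--   8 : primitive recursion on x = pair a n:
--         h(a,0) = F a,  h(a,n+1) = G (pair a (pair n (h(a,n))))
--   9 : minimisation x ↦ μn. r(pair x n) = 0
--   other tags : nowhere defined
-- eval k α e x is the computation with fuel k (nothing = not (yet) converged).

mutual
  eval : ℕ → Baire → ℕ → ℕ → Maybe ℕ
  eval zero    α e x = nothing
  eval (suc k) α e x = run k α (fst e) (snd e) x

  run : ℕ → Baire → ℕ → ℕ → ℕ → Maybe ℕ
  run k α 0 r x = just 0
  run k α 1 r x = just (suc x)
  run k α 2 r x = just x
  run k α 3 r x = just (α x)
  run k α 4 r x = just (fst x)
  run k α 5 r x = just (snd x)
  run k α 6 r x = eval k α (snd r) x >>= eval k α (fst r)
  run k α 7 r x = eval k α (fst r) x >>= λ a → eval k α (snd r) x >>= λ b → just (pair a b)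
  run k α 8 r x = recur k α (fst r) (snd r) (fst x) (snd x)
  run k α 9 r x = search k α r x 0 k
  run k α _ r x = nothing

  recur : ℕ → Baire → ℕ → ℕ → ℕ → ℕ → Maybe ℕ
  recur k α F G a zero    = eval k α F a
  recur k α F G a (suc n) = recur k α F G a n >>= λ h → eval k α G (pair a (pair n h))

  search : ℕ → Baire → ℕ → ℕ → ℕ → ℕ → Maybe ℕ
  search k α c x n zero    = nothing
  search k α c x n (suc b) = eval k α c (pair x n) >>= searchStep k α c x n b

  searchStep : ℕ → Baire → ℕ → ℕ → ℕ → ℕ → ℕ → Maybe ℕ
  searchStep k α c x n b zero    = just n
  searchStep k α c x n b (suc _) = search k α c x (suc n) b

_⟦_⟧↦_ : ℕ → Baire → Baire → Set
e ⟦ α ⟧↦ β = ∀ n → ∃ λ k → eval k α e n ≡ just (β n)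

record Problem : Set₁ where
  field
    dom : Baire → Set
    val : Baire → Baire → Set
open Problem public

IsMultiFunction : Problem → Set
IsMultiFunction f = ∀ x → dom f x → ∃ λ y → val f x y

Extensional : Problem → Set
Extensional f =
  (∀ x x′ → x ≗ x′ → dom f x → dom f x′) ×
  (∀ x x′ y y′ → x ≗ x′ → y ≗ y′ → val f x y → val f x′ y′)

-- Weihrauch reducibility, with multi-argument functionals Φ(p,q) := Φ(⟨p,q⟩)
_≤W_ : Problem → Problem → Set
f ≤W g = Σ ℕ λ a → Σ ℕ λ b → ∀ x → dom f x →
  (∃ λ y → (a ⟦ x ⟧↦ y) × dom g y) ×
  (∀ y → a ⟦ x ⟧↦ y → ∀ z → val g y z →
     ∃ λ w → (b ⟦ ⟨ x , z ⟩ ⟧↦ w) × val f x w)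

_⊠_ : Problem → Problem → Problem
dom (f ⊠ g) x   = dom f (left x) × dom g (right x)
val (f ⊠ g) x y = val f (left x) (left y) × val g (right x) (right y)

-- ℕ × ℕ × ℕ^ℕ is represented in Baire space by (e , i , p) ↦ e ∷ i ∷ p
qIdx₁ qIdx₂ : Baire → ℕ
qIdx₁ x = x 0
qIdx₂ x = x 1

qArg : Baire → Baire
qArg x n = x (suc (suc n))

-- parallel quotient f/g, with Φ_e(p,q) = Φ_e⟨p,q⟩ and Φ_i(p,q,r) = Φ_i⟨p,⟨q,r⟩⟩
_/W_ : Problem → Problem → Problem
dom (f /W g) x =
  ∀ q → dom g q →
    (∃ λ a → (qIdx₁ x ⟦ ⟨ qArg x , q ⟩ ⟧↦ a) × dom f a) ×
    (∀ a → qIdx₁ x ⟦ ⟨ qArg x , q ⟩ ⟧↦ a → ∀ r → val f a r →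
       ∃ λ b → (qIdx₂ x ⟦ ⟨ qArg x , ⟨ q , r ⟩ ⟩ ⟧↦ b) × val g q b)
-- y = ⟨q , r⟩ with q = left y, r = right y
val (f /W g) x y =
  dom g (left y) ×
  ∃ λ a → (qIdx₁ x ⟦ ⟨ qArg x , left y ⟩ ⟧↦ a) × val f a (right y)

-- For (f/g) × g ≤W f, the instance ⟨ (e , i , p) , q ⟩ is sent to Φₑ(p,q), and an
-- f-solution r of it is sent back to ⟨ ⟨ q , r ⟩ , Φᵢ(p,q,r) ⟩; the domain condition
-- of f/g says exactly that this works. Conversely, if Φ_a, Φ_b reduce h × g to f, an
-- h-instance x goes to the f/g-instance (a , i , x), where Φᵢ(x,q,r) is the g-half of
-- Φ_b(⟨x,q⟩,r); a solution ⟨ q , r ⟩ of it yields the h-half of Φ_b(⟨x,q⟩,r).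
-- Since these functionals read indices off their input, they are built from a
-- universal functional for the enumeration Φ: a small-step machine for eval is
-- iterated by primitive recursion, and a single search finds the halting time.

module Submission where

open import Defs
open import Data.Nat
open import Data.Nat.Properties
open import Data.Product using (∃; _×_; _,_; proj₁; proj₂)
open import Data.Maybe.Base using (Maybe; just; nothing; _>>=_)
open import Data.Sum using (_⊎_; inj₁; inj₂)
open import Data.Empty using (⊥-elim)
open import Data.List using (List; []; _∷_)
open import Relation.Binary.PropositionalEquality

unpair-tri+ : ∀ s a → a ≤ s → unpair (tri s + a) ≡ (a , s ∸ a)
unpair-tri+ zero    zero    _   = refl
unpair-tri+ (suc s) zero    _   rewrite +-identityʳ (tri s + suc s) | +-suc (tri s) s
  | unpair-tri+ s s ≤-refl | n∸n≡0 s = refl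
unpair-tri+ s       (suc a) a<s rewrite +-suc (tri s) a | unpair-tri+ s a (≤-trans (n≤1+n a) a<s)
  | +-∸-assoc 1 a<s = refl

unpair-pair : ∀ a b → unpair (pair a b) ≡ (a , b)
unpair-pair a b rewrite unpair-tri+ (a + b) a (m≤m+n a b) | m+n∸m≡n a b = refl

fst-pair : ∀ a b → fst (pair a b) ≡ a
fst-pair a b = cong proj₁ (unpair-pair a b)

snd-pair : ∀ a b → snd (pair a b) ≡ b
snd-pair a b = cong proj₂ (unpair-pair a b)

-- Codes, expressions and machine states are built with an opaque copy of
-- pair, so that normalisation never unfolds the Cantor pairing.
opaque
  pr : ℕ → ℕ → ℕ
  pr = pair

  pr≡pair : ∀ a b → pr a b ≡ pair a b
  pr≡pair a b = refl

fst-pr : ∀ a b → fst (pr a b) ≡ a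
fst-pr a b = trans (cong fst (pr≡pair a b)) (fst-pair a b)

snd-pr : ∀ a b → snd (pr a b) ≡ b
snd-pr a b = trans (cong snd (pr≡pair a b)) (snd-pair a b)

>>=-just-inv : ∀ {m : Maybe ℕ} {f : ℕ → Maybe ℕ} {v} → (m >>= f) ≡ just v →
               ∃ λ u → m ≡ just u × f u ≡ just v
>>=-just-inv {just u} eq = u , refl , eq

>>=-just : ∀ {m : Maybe ℕ} {f : ℕ → Maybe ℕ} {u v} → m ≡ just u → f u ≡ just v → (m >>= f) ≡ just v
>>=-just refl eq = eq

>>=-cong : ∀ {m m′ : Maybe ℕ} {f f′ : ℕ → Maybe ℕ} → m ≡ m′ → (∀ u → f u ≡ f′ u) → (m >>= f) ≡ (m′ >>= f′)
>>=-cong {just u}  refl eq = eq u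
>>=-cong {nothing} refl eq = refl

just-injective : ∀ {a b : ℕ} → just a ≡ just b → a ≡ b
just-injective refl = refl

mutual
  eval-mono : ∀ {k k′} α e x {v} → k ≤ k′ → eval k α e x ≡ just v → eval k′ α e x ≡ just v
  eval-mono {suc k} {suc k′} α e x (s≤s le) eq = run-mono α (fst e) (snd e) x le eq

  run-mono : ∀ {k k′} α t r x {v} → k ≤ k′ → run k α t r x ≡ just v → run k′ α t r x ≡ just v
  run-mono α 0 r x le eq = eq
  run-mono α 1 r x le eq = eq
  run-mono α 2 r x le eq = eq
  run-mono α 3 r x le eq = eq
  run-mono α 4 r x le eq = eq
  run-mono α 5 r x le eq = eq
  run-mono {k} α 6 r x le eq with >>=-just-inv {eval k α (snd r) x} {eval k α (fst r)} eq
  ... | u , e₁ , e₂ = >>=-just (eval-mono α (snd r) x le e₁) (eval-mono α (fst r) u le e₂)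
  run-mono {k} α 7 r x le eq
    with >>=-just-inv {eval k α (fst r) x} {λ a → eval k α (snd r) x >>= λ b → just (pair a b)} eq
  ... | u , e₁ , e₂ with >>=-just-inv {eval k α (snd r) x} {λ b → just (pair u b)} e₂
  ... | w , e₃ , e₄ = >>=-just (eval-mono α (fst r) x le e₁) (>>=-just (eval-mono α (snd r) x le e₃) e₄)
  run-mono α 8 r x le eq = recur-mono α (fst r) (snd r) (fst x) (snd x) le eq
  run-mono α 9 r x le eq = search-mono α r x 0 le le eq

  recur-mono : ∀ {k k′} α F G a n {v} → k ≤ k′ → recur k α F G a n ≡ just v → recur k′ α F G a n ≡ just v
  recur-mono α F G a zero le eq = eval-mono α F a le eq
  recur-mono {k} α F G a (suc n) le eq
    with >>=-just-inv {recur k α F G a n} {λ h → eval k α G (pair a (pair n h))} eq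
  ... | h , e₁ , e₂ = >>=-just (recur-mono α F G a n le e₁) (eval-mono α G _ le e₂)

  search-mono : ∀ {k k′ b b′} α c x n {v} → k ≤ k′ → b ≤ b′ →
                search k α c x n b ≡ just v → search k′ α c x n b′ ≡ just v
  search-mono {k} {b = suc b} {suc b′} α c x n le (s≤s lb) eq
    with >>=-just-inv {eval k α c (pair x n)} {searchStep k α c x n b} eq
  ... | zero  , e₁ , e₂ = >>=-just (eval-mono α c (pair x n) le e₁) e₂
  ... | suc u , e₁ , e₂ = >>=-just (eval-mono α c (pair x n) le e₁) (search-mono α c x (suc n) le lb e₂)

mutual
  eval-ext : ∀ k {α β} → α ≗ β → ∀ e x → eval k α e x ≡ eval k β e x
  eval-ext zero    α≗β e x = refl
  eval-ext (suc k) α≗β e x = run-ext k α≗β (fst e) (snd e) x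

  run-ext : ∀ k {α β} → α ≗ β → ∀ t r x → run k α t r x ≡ run k β t r x
  run-ext k α≗β 0 r x = refl
  run-ext k α≗β 1 r x = refl
  run-ext k α≗β 2 r x = refl
  run-ext k α≗β 3 r x = cong just (α≗β x)
  run-ext k α≗β 4 r x = refl
  run-ext k α≗β 5 r x = refl
  run-ext k α≗β 6 r x = >>=-cong (eval-ext k α≗β (snd r) x) (eval-ext k α≗β (fst r))
  run-ext k α≗β 7 r x =
    >>=-cong (eval-ext k α≗β (fst r) x) (λ _ → >>=-cong (eval-ext k α≗β (snd r) x) (λ _ → refl))
  run-ext k α≗β 8 r x = recur-ext k α≗β (fst r) (snd r) (fst x) (snd x)
  run-ext k α≗β 9 r x = search-ext k α≗β r x 0 k
  run-ext k α≗β (suc (suc (suc (suc (suc (suc (suc (suc (suc (suc t)))))))))) r x = refl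

  recur-ext : ∀ k {α β} → α ≗ β → ∀ F G a n → recur k α F G a n ≡ recur k β F G a n
  recur-ext k α≗β F G a zero    = eval-ext k α≗β F a
  recur-ext k α≗β F G a (suc n) = >>=-cong (recur-ext k α≗β F G a n) (λ _ → eval-ext k α≗β G _)

  search-ext : ∀ k {α β} → α ≗ β → ∀ c x n b → search k α c x n b ≡ search k β c x n b
  search-ext k α≗β c x n zero    = refl
  search-ext k α≗β c x n (suc b) = >>=-cong (eval-ext k α≗β c (pair x n)) searchStep-ext
    where
    searchStep-ext : ∀ u → searchStep k _ c x n b u ≡ searchStep k _ c x n b u
    searchStep-ext zero    = refl
    searchStep-ext (suc u) = search-ext k α≗β c x (suc n) b

_⇓[_]_↦_ : ℕ → Baire → ℕ → ℕ → Set
e ⇓[ α ] x ↦ v = ∃ λ k → eval k α e x ≡ just v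

⇓-det : ∀ {α e x v v′} → e ⇓[ α ] x ↦ v → e ⇓[ α ] x ↦ v′ → v ≡ v′
⇓-det {α} {e} {x} (k , p) (k′ , p′) = just-injective
  (trans (sym (eval-mono α e x (m≤m⊔n k k′) p)) (eval-mono α e x (m≤n⊔m k k′) p′))

⇓-oracle-ext : ∀ {α β e x v} → α ≗ β → e ⇓[ α ] x ↦ v → e ⇓[ β ] x ↦ v
⇓-oracle-ext {e = e} {x} α≗β (k , p) = k , trans (sym (eval-ext k α≗β e x)) p

⇓-resp : ∀ {α e x v v′} → v ≡ v′ → e ⇓[ α ] x ↦ v → e ⇓[ α ] x ↦ v′
⇓-resp refl h = h

pr²≡pair² : ∀ a b c → pr a (pr b c) ≡ pair a (pair b c)
pr²≡pair² a b c = trans (cong (pr a) (pr≡pair b c)) (pr≡pair a (pair b c))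

eval-suc-pr : ∀ k α t r x → eval (suc k) α (pr t r) x ≡ run k α t r x
eval-suc-pr k α t r x rewrite fst-pr t r | snd-pr t r = refl

cZero cSucc cId cOracle cFst cSnd : ℕ
cZero   = pr 0 0
cSucc   = pr 1 0
cId     = pr 2 0
cOracle = pr 3 0
cFst    = pr 4 0
cSnd    = pr 5 0

cComp cPair cRec : ℕ → ℕ → ℕ
cComp F G = pr 6 (pr F G)
cPair F G = pr 7 (pr F G)
cRec  F G = pr 8 (pr F G)

cMin : ℕ → ℕ
cMin c = pr 9 c

natrec : (ℕ → ℕ) → (ℕ → ℕ) → ℕ → ℕ → ℕ
natrec f g a zero    = f a
natrec f g a (suc n) = g (pr a (pr n (natrec f g a n)))

module _ {α : Baire} where
  cZero⇓ : ∀ x → cZero ⇓[ α ] x ↦ 0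
  cZero⇓ x = 1 , eval-suc-pr 0 α 0 0 x

  cSucc⇓ : ∀ x → cSucc ⇓[ α ] x ↦ suc x
  cSucc⇓ x = 1 , eval-suc-pr 0 α 1 0 x

  cId⇓ : ∀ x → cId ⇓[ α ] x ↦ x
  cId⇓ x = 1 , eval-suc-pr 0 α 2 0 x

  cOracle⇓ : ∀ x → cOracle ⇓[ α ] x ↦ α x
  cOracle⇓ x = 1 , eval-suc-pr 0 α 3 0 x

  cFst⇓ : ∀ x → cFst ⇓[ α ] x ↦ fst x
  cFst⇓ x = 1 , eval-suc-pr 0 α 4 0 x

  cSnd⇓ : ∀ x → cSnd ⇓[ α ] x ↦ snd x
  cSnd⇓ x = 1 , eval-suc-pr 0 α 5 0 x

  cComp⇓ : ∀ {F G x u v} → G ⇓[ α ] x ↦ u → F ⇓[ α ] u ↦ v → cComp F G ⇓[ α ] x ↦ v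
  cComp⇓ {F} {G} {x} {u} (k₁ , p₁) (k₂ , p₂) = suc (k₁ ⊔ k₂) , goal
    where
    goal : eval (suc (k₁ ⊔ k₂)) α (cComp F G) x ≡ _
    goal rewrite eval-suc-pr (k₁ ⊔ k₂) α 6 (pr F G) x | fst-pr F G | snd-pr F G =
      >>=-just (eval-mono α G x (m≤m⊔n k₁ k₂) p₁) (eval-mono α F u (m≤n⊔m k₁ k₂) p₂)

  cPair⇓ : ∀ {F G x u w} → F ⇓[ α ] x ↦ u → G ⇓[ α ] x ↦ w → cPair F G ⇓[ α ] x ↦ pair u w
  cPair⇓ {F} {G} {x} (k₁ , p₁) (k₂ , p₂) = suc (k₁ ⊔ k₂) , goal
    where
    goal : eval (suc (k₁ ⊔ k₂)) α (cPair F G) x ≡ _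
    goal rewrite eval-suc-pr (k₁ ⊔ k₂) α 7 (pr F G) x | fst-pr F G | snd-pr F G =
      >>=-just (eval-mono α F x (m≤m⊔n k₁ k₂) p₁) (>>=-just (eval-mono α G x (m≤n⊔m k₁ k₂) p₂) refl)

  recur-total : ∀ {F G f g} → (∀ y → F ⇓[ α ] y ↦ f y) → (∀ y → G ⇓[ α ] y ↦ g y) →
                ∀ a n → ∃ λ k → recur k α F G a n ≡ just (natrec f g a n)
  recur-total hF hG a zero = hF a
  recur-total {F} {G} {f} {g} hF hG a (suc n)
    with recur-total hF hG a n | hG (pr a (pr n (natrec f g a n)))
  ... | k₁ , p₁ | k₂ , p₂ = k₁ ⊔ k₂ , >>=-just (recur-mono α F G a n (m≤m⊔n k₁ k₂) p₁)
    (eval-mono α G _ (m≤n⊔m k₁ k₂)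
      (subst (λ y → eval k₂ α G y ≡ just (natrec f g a (suc n))) (pr²≡pair² a n _) p₂))

  cRec⇓ : ∀ {F G f g} → (∀ y → F ⇓[ α ] y ↦ f y) → (∀ y → G ⇓[ α ] y ↦ g y) →
          ∀ x → cRec F G ⇓[ α ] x ↦ natrec f g (fst x) (snd x)
  cRec⇓ {F} {G} hF hG x with recur-total hF hG (fst x) (snd x)
  ... | k , p = suc k , goal
    where
    goal : eval (suc k) α (cRec F G) x ≡ _
    goal rewrite eval-suc-pr k α 8 (pr F G) x | fst-pr F G | snd-pr F G = p

  cRec⇓-depth0 : ∀ {F G x a} → F ⇓[ α ] x ↦ a → cRec F G ⇓[ α ] pair x 0 ↦ a
  cRec⇓-depth0 {F} {G} {x} (k , p) = suc k , goal
    where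
    goal : eval (suc k) α (cRec F G) (pair x 0) ≡ _
    goal rewrite eval-suc-pr k α 8 (pr F G) (pair x 0) | fst-pr F G | snd-pr F G
      | fst-pair x 0 | snd-pair x 0 = p

  cRec⇓-depth1 : ∀ {F G x a b} → F ⇓[ α ] x ↦ a → G ⇓[ α ] pair x (pair 0 a) ↦ b →
                 cRec F G ⇓[ α ] pair x 1 ↦ b
  cRec⇓-depth1 {F} {G} {x} (k₁ , p₁) (k₂ , p₂) = suc (k₁ ⊔ k₂) , goal
    where
    goal : eval (suc (k₁ ⊔ k₂)) α (cRec F G) (pair x 1) ≡ _
    goal rewrite eval-suc-pr (k₁ ⊔ k₂) α 8 (pr F G) (pair x 1) | fst-pr F G | snd-pr F G
      | fst-pair x 1 | snd-pair x 1 =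
      >>=-just (eval-mono α F x (m≤m⊔n k₁ k₂) p₁) (eval-mono α G _ (m≤n⊔m k₁ k₂) p₂)

  uniform-fuel : ∀ {c} (y cv : ℕ → ℕ) → (∀ j → c ⇓[ α ] y j ↦ cv j) →
                 ∀ m → ∃ λ K → ∀ j → j ≤ m → eval K α c (y j) ≡ just (cv j)
  uniform-fuel y cv h zero with h 0
  ... | k , p = k , λ { zero _ → p }
  uniform-fuel {c} y cv h (suc m) with uniform-fuel y cv h m | h (suc m)
  ... | K , ps | k , p = K ⊔ k , below
    where
    below : ∀ j → j ≤ suc m → eval (K ⊔ k) α c (y j) ≡ just (cv j)
    below j j≤1+m with m≤n⇒m<n∨m≡n j≤1+m
    ... | inj₁ (s≤s j≤m) = eval-mono α c (y j) (m≤m⊔n K k) (ps j j≤m)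
    ... | inj₂ refl      = eval-mono α c (y j) (m≤n⊔m K k) p

  search-finds : ∀ K c x (cv : ℕ → ℕ) m → (∀ j → j ≤ m → eval K α c (pair x j) ≡ just (cv j)) → cv m ≡ 0 →
                 ∀ n b → n ≤ m → m < n + b → ∃ λ j → search K α c x n b ≡ just j × cv j ≡ 0
  search-finds K c x cv m hs hm n zero n≤m m<n+0 rewrite +-identityʳ n = ⊥-elim (<⇒≱ m<n+0 n≤m)
  search-finds K c x cv m hs hm n (suc b) n≤m m<n+b with cv n in eq
  ... | zero  = n , >>=-just (trans (hs n n≤m) (cong just eq)) refl , eq
  ... | suc _ with m≤n⇒m<n∨m≡n n≤m
  ...   | inj₂ refl = ⊥-elim (0≢1+n (trans (sym hm) eq))
  ...   | inj₁ n<m with search-finds K c x cv m hs hm (suc n) b n<m (subst (m <_) (+-suc n b) m<n+b)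
  ...     | j , p , q = j , >>=-just (trans (hs n n≤m) (cong just eq)) p , q

  cMin⇓ : ∀ {c x} (cv : ℕ → ℕ) m → (∀ j → c ⇓[ α ] pair x j ↦ cv j) → cv m ≡ 0 →
          ∃ λ j → cv j ≡ 0 × cMin c ⇓[ α ] x ↦ j
  cMin⇓ {c} {x} cv m h hm with uniform-fuel (pair x) cv h m
  ... | K , ps with search-finds (K ⊔ suc m) c x cv m
                      (λ j j≤m → eval-mono α c (pair x j) (m≤m⊔n K (suc m)) (ps j j≤m)) hm
                      0 (K ⊔ suc m) z≤n (≤-trans (n<1+n m) (m≤n⊔m K (suc m)))
  ... | j , p , q = j , q , suc (K ⊔ suc m) , trans (eval-suc-pr (K ⊔ suc m) α 9 c x) p

data Exp : Set where
  Z S I O Fst Snd Pred : Exp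
  _∘E_ : Exp → Exp → Exp
  ⟪_,_⟫ : Exp → Exp → Exp
  R : Exp → Exp → Exp
  If : Exp → Exp → Exp → Exp

infixr 9 _∘E_

ifz : ℕ → ℕ → ℕ → ℕ
ifz zero    a b = a
ifz (suc _) a b = b

⟦_⟧ : Exp → Baire → ℕ → ℕ
⟦ Z ⟧        α x = 0
⟦ S ⟧        α x = suc x
⟦ I ⟧        α x = x
⟦ O ⟧        α x = α x
⟦ Fst ⟧      α x = fst x
⟦ Snd ⟧      α x = snd x
⟦ Pred ⟧     α x = pred x
⟦ A ∘E B ⟧   α x = ⟦ A ⟧ α (⟦ B ⟧ α x)
⟦ ⟪ A , B ⟫ ⟧ α x = pr (⟦ A ⟧ α x) (⟦ B ⟧ α x)
⟦ R F G ⟧    α x = natrec (⟦ F ⟧ α) (⟦ G ⟧ α) (fst x) (snd x)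
⟦ If C A B ⟧ α x = ifz (⟦ C ⟧ α x) (⟦ A ⟧ α x) (⟦ B ⟧ α x)

-- pred x is natrec (λ _ → 0) (fst ∘ snd) 0 x; If C A B x is a recursion of depth C x.
compile : Exp → ℕ
compile Z          = cZero
compile S          = cSucc
compile I          = cId
compile O          = cOracle
compile Fst        = cFst
compile Snd        = cSnd
compile Pred       = cComp (cRec cZero (cComp cFst cSnd)) (cPair cZero cId)
compile (A ∘E B)   = cComp (compile A) (compile B)
compile ⟪ A , B ⟫  = cPair (compile A) (compile B)
compile (R F G)    = cRec (compile F) (compile G)
compile (If C A B) = cComp (cRec (compile A) (cComp (compile B) cFst)) (cPair cId (compile C))

compile-correct : ∀ E α x → compile E ⇓[ α ] x ↦ ⟦ E ⟧ α x
compile-correct Z    α x = cZero⇓ x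
compile-correct S    α x = cSucc⇓ x
compile-correct I    α x = cId⇓ x
compile-correct O    α x = cOracle⇓ x
compile-correct Fst  α x = cFst⇓ x
compile-correct Snd  α x = cSnd⇓ x
compile-correct Pred α x = ⇓-resp (natrec-pred x)
  (cComp⇓ (cPair⇓ (cZero⇓ x) (cId⇓ x)) (cRec⇓ cZero⇓ (λ y → cComp⇓ (cSnd⇓ y) (cFst⇓ (snd y))) (pair 0 x)))
  where
  natrec-pred : ∀ x → natrec (λ _ → 0) (λ y → fst (snd y)) (fst (pair 0 x)) (snd (pair 0 x)) ≡ pred x
  natrec-pred x rewrite fst-pair 0 x | snd-pair 0 x with x
  ... | zero  = refl
  ... | suc n rewrite snd-pr 0 (pr n (natrec (λ _ → 0) (λ y → fst (snd y)) 0 n))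
    | fst-pr n (natrec (λ _ → 0) (λ y → fst (snd y)) 0 n) = refl
compile-correct (A ∘E B)  α x = cComp⇓ (compile-correct B α x) (compile-correct A α _)
compile-correct ⟪ A , B ⟫ α x =
  ⇓-resp (sym (pr≡pair _ _)) (cPair⇓ (compile-correct A α x) (compile-correct B α x))
compile-correct (R F G)   α x = cRec⇓ (compile-correct F α) (compile-correct G α) x
compile-correct (If C A B) α x = ⇓-resp (natrec-ifz (⟦ C ⟧ α x))
  (cComp⇓ (cPair⇓ (cId⇓ x) (compile-correct C α x))
          (cRec⇓ (compile-correct A α) (λ y → cComp⇓ (cFst⇓ y) (compile-correct B α (fst y)))
                 (pair x (⟦ C ⟧ α x))))
  where
  natrec-ifz : ∀ c → natrec (⟦ A ⟧ α) (λ y → ⟦ B ⟧ α (fst y)) (fst (pair x c)) (snd (pair x c))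
                     ≡ ifz c (⟦ A ⟧ α x) (⟦ B ⟧ α x)
  natrec-ifz c rewrite fst-pair x c | snd-pair x c with c
  ... | zero  = refl
  ... | suc n rewrite fst-pr x (pr n (natrec (⟦ A ⟧ α) (λ y → ⟦ B ⟧ α (fst y)) x n)) = refl

lit : ℕ → Exp
lit zero    = Z
lit (suc n) = S ∘E lit n

⟦lit⟧ : ∀ n α x → ⟦ lit n ⟧ α x ≡ n
⟦lit⟧ zero    α x = refl
⟦lit⟧ (suc n) α x = cong suc (⟦lit⟧ n α x)

switch : Exp → List Exp → Exp → Exp
switch T []       D = D
switch T (A ∷ As) D = If T A (switch (Pred ∘E T) As D)

-- States of a small-step machine for eval: evalState e x K runs code e on x,
-- returnState v K hands v to the stack K (0 is empty, push F K = suc (pr F K)).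
-- Frames: pr 0 F  apply F next;  pr 1 (pr G x)  then run G on x;  pr 2 a  pair a with
-- the value;  pr 3 (pr G (pr a (pr m i)))  m more recursion steps from i;
-- pr 4 (pr c (pr x n))  the search is at n.
evalState : ℕ → ℕ → ℕ → ℕ
evalState e x K = pr 0 (pr (pr e x) K)

returnState : ℕ → ℕ → ℕ
returnState v K = pr 1 (pr v K)

push : ℕ → ℕ → ℕ
push F K = suc (pr F K)

evalStateE : Exp → Exp → Exp → Exp
evalStateE E X K = ⟪ Z , ⟪ ⟪ E , X ⟫ , K ⟫ ⟫

returnStateE : Exp → Exp → Exp
returnStateE V K = ⟪ lit 1 , ⟪ V , K ⟫ ⟫

pushE : Exp → Exp → Exp
pushE F K = S ∘E ⟪ F , K ⟫

-- The simulated computation consults the oracle X ∘ ⟦ T ⟧ X.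
module Machine (T : Exp) where
  codeE argE stackE tagE bodyE : Exp
  codeE  = Fst ∘E Fst ∘E Snd
  argE   = Snd ∘E Fst ∘E Snd
  stackE = Snd ∘E Snd
  tagE   = Fst ∘E codeE
  bodyE  = Snd ∘E codeE

  valE tailE frameTagE frameE GE aE mE iE nE : Exp
  valE      = Fst ∘E Snd
  tailE     = Snd ∘E Pred ∘E stackE
  frameTagE = Fst ∘E Fst ∘E Pred ∘E stackE
  frameE    = Snd ∘E Fst ∘E Pred ∘E stackE
  GE        = Fst ∘E frameE
  aE        = Fst ∘E Snd ∘E frameE
  mE        = Fst ∘E Snd ∘E Snd ∘E frameE
  iE        = Snd ∘E Snd ∘E Snd ∘E frameE
  nE        = Snd ∘E Snd ∘E frameE

  evalStepE returnStepE stepE : Exp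
  evalStepE = switch tagE
    ( returnStateE Z stackE
    ∷ returnStateE (S ∘E argE) stackE
    ∷ returnStateE argE stackE
    ∷ returnStateE (O ∘E T ∘E argE) stackE
    ∷ returnStateE (Fst ∘E argE) stackE
    ∷ returnStateE (Snd ∘E argE) stackE
    ∷ evalStateE (Snd ∘E bodyE) argE (pushE ⟪ Z , Fst ∘E bodyE ⟫ stackE)
    ∷ evalStateE (Fst ∘E bodyE) argE (pushE ⟪ lit 1 , ⟪ Snd ∘E bodyE , argE ⟫ ⟫ stackE)
    ∷ evalStateE (Fst ∘E bodyE) (Fst ∘E argE)
        (pushE ⟪ lit 3 , ⟪ Snd ∘E bodyE , ⟪ Fst ∘E argE , ⟪ Snd ∘E argE , Z ⟫ ⟫ ⟫ ⟫ stackE)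
    ∷ evalStateE bodyE ⟪ argE , Z ⟫ (pushE ⟪ lit 4 , ⟪ bodyE , ⟪ argE , Z ⟫ ⟫ ⟫ stackE)
    ∷ []) I
  returnStepE = If stackE I (switch frameTagE
    ( evalStateE frameE valE tailE
    ∷ evalStateE (Fst ∘E frameE) (Snd ∘E frameE) (pushE ⟪ lit 2 , valE ⟫ tailE)
    ∷ returnStateE ⟪ frameE , valE ⟫ tailE
    ∷ If mE (returnStateE valE tailE)
            (evalStateE GE ⟪ aE , ⟪ iE , valE ⟫ ⟫
              (pushE ⟪ lit 3 , ⟪ GE , ⟪ aE , ⟪ Pred ∘E mE , S ∘E iE ⟫ ⟫ ⟫ ⟫ tailE))
    ∷ [])
    (If valE (returnStateE nE tailE)
             (evalStateE GE ⟪ aE , S ∘E nE ⟫ (pushE ⟪ lit 4 , ⟪ GE , ⟪ aE , S ∘E nE ⟫ ⟫ ⟫ tailE))))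
  stepE = If Fst evalStepE returnStepE

  module _ (X : Baire) where
    step : ℕ → ℕ
    step = ⟦ stepE ⟧ X

    α′ : Baire
    α′ m = X (⟦ T ⟧ X m)

    evalStep : ℕ → ℕ → ℕ → ℕ → ℕ → ℕ
    evalStep e 0 r x K = returnState 0 K
    evalStep e 1 r x K = returnState (suc x) K
    evalStep e 2 r x K = returnState x K
    evalStep e 3 r x K = returnState (α′ x) K
    evalStep e 4 r x K = returnState (fst x) K
    evalStep e 5 r x K = returnState (snd x) K
    evalStep e 6 r x K = evalState (snd r) x (push (pr 0 (fst r)) K)
    evalStep e 7 r x K = evalState (fst r) x (push (pr 1 (pr (snd r) x)) K)
    evalStep e 8 r x K = evalState (fst r) (fst x) (push (pr 3 (pr (snd r) (pr (fst x) (pr (snd x) 0)))) K)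
    evalStep e 9 r x K = evalState r (pr x 0) (push (pr 4 (pr r (pr x 0))) K)
    evalStep e (suc (suc (suc (suc (suc (suc (suc (suc (suc (suc t)))))))))) r x K = evalState e x K

    step-eval : ∀ e x K {t r} → fst e ≡ t → snd e ≡ r → step (evalState e x K) ≡ evalStep e t r x K
    step-eval e x K refl refl rewrite fst-pr 0 (pr (pr e x) K) | snd-pr 0 (pr (pr e x) K)
      | fst-pr (pr e x) K | snd-pr (pr e x) K | fst-pr e x | snd-pr e x with fst e
    ... | 0 = refl
    ... | 1 = refl
    ... | 2 = refl
    ... | 3 = refl
    ... | 4 = refl
    ... | 5 = refl
    ... | 6 = refl
    ... | 7 = refl
    ... | 8 = refl
    ... | 9 = refl
    ... | suc (suc (suc (suc (suc (suc (suc (suc (suc (suc t))))))))) = refl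

    step-halted : ∀ v → step (returnState v 0) ≡ returnState v 0
    step-halted v rewrite fst-pr 1 (pr v 0) | snd-pr 1 (pr v 0) | snd-pr v 0 = refl

    step-comp : ∀ v F K → step (returnState v (push (pr 0 F) K)) ≡ evalState F v K
    step-comp v F K rewrite fst-pr 1 (pr v (push (pr 0 F) K)) | snd-pr 1 (pr v (push (pr 0 F) K))
      | fst-pr v (push (pr 0 F) K) | snd-pr v (push (pr 0 F) K) | fst-pr (pr 0 F) K | snd-pr (pr 0 F) K
      | fst-pr 0 F | snd-pr 0 F = refl

    step-pairˡ : ∀ v G x K → step (returnState v (push (pr 1 (pr G x)) K)) ≡ evalState G x (push (pr 2 v) K)
    step-pairˡ v G x K rewrite fst-pr 1 (pr v (push (pr 1 (pr G x)) K)) | snd-pr 1 (pr v (push (pr 1 (pr G x)) K))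
      | fst-pr v (push (pr 1 (pr G x)) K) | snd-pr v (push (pr 1 (pr G x)) K)
      | fst-pr (pr 1 (pr G x)) K | snd-pr (pr 1 (pr G x)) K
      | fst-pr 1 (pr G x) | snd-pr 1 (pr G x) | fst-pr G x | snd-pr G x = refl

    step-pairʳ : ∀ v a K → step (returnState v (push (pr 2 a) K)) ≡ returnState (pr a v) K
    step-pairʳ v a K rewrite fst-pr 1 (pr v (push (pr 2 a) K)) | snd-pr 1 (pr v (push (pr 2 a) K))
      | fst-pr v (push (pr 2 a) K) | snd-pr v (push (pr 2 a) K) | fst-pr (pr 2 a) K | snd-pr (pr 2 a) K
      | fst-pr 2 a | snd-pr 2 a = refl

    step-rec : ∀ v G a m i K → step (returnState v (push (pr 3 (pr G (pr a (pr m i)))) K)) ≡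
      ifz m (returnState v K) (evalState G (pr a (pr i v)) (push (pr 3 (pr G (pr a (pr (pred m) (suc i))))) K))
    step-rec v G a m i K rewrite fst-pr 1 (pr v (push (pr 3 (pr G (pr a (pr m i)))) K))
      | snd-pr 1 (pr v (push (pr 3 (pr G (pr a (pr m i)))) K))
      | fst-pr v (push (pr 3 (pr G (pr a (pr m i)))) K) | snd-pr v (push (pr 3 (pr G (pr a (pr m i)))) K)
      | fst-pr (pr 3 (pr G (pr a (pr m i)))) K | snd-pr (pr 3 (pr G (pr a (pr m i)))) K
      | fst-pr 3 (pr G (pr a (pr m i))) | snd-pr 3 (pr G (pr a (pr m i)))
      | fst-pr G (pr a (pr m i)) | snd-pr G (pr a (pr m i)) | fst-pr a (pr m i) | snd-pr a (pr m i)
      | fst-pr m i | snd-pr m i = refl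

    step-min : ∀ v c x n K → step (returnState v (push (pr 4 (pr c (pr x n))) K)) ≡
      ifz v (returnState n K) (evalState c (pr x (suc n)) (push (pr 4 (pr c (pr x (suc n)))) K))
    step-min v c x n K rewrite fst-pr 1 (pr v (push (pr 4 (pr c (pr x n))) K))
      | snd-pr 1 (pr v (push (pr 4 (pr c (pr x n))) K))
      | fst-pr v (push (pr 4 (pr c (pr x n))) K) | snd-pr v (push (pr 4 (pr c (pr x n))) K)
      | fst-pr (pr 4 (pr c (pr x n))) K | snd-pr (pr 4 (pr c (pr x n))) K
      | fst-pr 4 (pr c (pr x n)) | snd-pr 4 (pr c (pr x n))
      | fst-pr c (pr x n) | snd-pr c (pr x n) | fst-pr x n | snd-pr x n = refl

    steps : ℕ → ℕ → ℕ
    steps zero    s = s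
    steps (suc m) s = step (steps m s)

    steps-+ : ∀ m n s → steps (m + n) s ≡ steps m (steps n s)
    steps-+ zero    n s = refl
    steps-+ (suc m) n s = cong step (steps-+ m n s)

    _⟶*_ : ℕ → ℕ → Set
    s ⟶* s′ = ∃ λ m → steps m s ≡ s′

    ⟶*-step : ∀ {s s′} → step s ≡ s′ → s ⟶* s′
    ⟶*-step eq = 1 , eq

    infixr 2 _▸_
    _▸_ : ∀ {s₁ s₂ s₃} → s₁ ⟶* s₂ → s₂ ⟶* s₃ → s₁ ⟶* s₃
    _▸_ {s₁} (m₁ , p₁) (m₂ , p₂) = m₂ + m₁ , trans (steps-+ m₂ m₁ s₁) (trans (cong (steps m₂) p₁) p₂)

    recur-prefix : ∀ k F G a j i {n v} → j + i ≡ n → recur k α′ F G a n ≡ just v →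
                   ∃ λ h → recur k α′ F G a i ≡ just h
    recur-prefix k F G a zero    i refl eq = _ , eq
    recur-prefix k F G a (suc j) i refl eq
      with >>=-just-inv {recur k α′ F G a (j + i)} {λ h → eval k α′ G (pair a (pair (j + i) h))} eq
    ... | _ , e₁ , _ = recur-prefix k F G a j i refl e₁

    mutual
      eval⇒⟶* : ∀ k e {x x′ v} → x′ ≡ x → eval k α′ e x ≡ just v → ∀ K →
                 evalState e x′ K ⟶* returnState v K
      eval⇒⟶* (suc k) e refl eq K = run⇒⟶* k (fst e) (snd e) e refl refl _ eq K

      run⇒⟶* : ∀ k t r e → fst e ≡ t → snd e ≡ r → ∀ x {v} → run k α′ t r x ≡ just v → ∀ K →
                evalState e x K ⟶* returnState v K
      run⇒⟶* k 0 r e p q x refl K = ⟶*-step (step-eval e x K p q)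
      run⇒⟶* k 1 r e p q x refl K = ⟶*-step (step-eval e x K p q)
      run⇒⟶* k 2 r e p q x refl K = ⟶*-step (step-eval e x K p q)
      run⇒⟶* k 3 r e p q x refl K = ⟶*-step (step-eval e x K p q)
      run⇒⟶* k 4 r e p q x refl K = ⟶*-step (step-eval e x K p q)
      run⇒⟶* k 5 r e p q x refl K = ⟶*-step (step-eval e x K p q)
      run⇒⟶* k 6 r e p q x eq K with >>=-just-inv {eval k α′ (snd r) x} {eval k α′ (fst r)} eq
      ... | u , e₁ , e₂ =
        ⟶*-step (step-eval e x K p q) ▸ eval⇒⟶* k (snd r) refl e₁ _ ▸
        ⟶*-step (step-comp u (fst r) K) ▸ eval⇒⟶* k (fst r) refl e₂ K
      run⇒⟶* k 7 r e p q x eq K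
        with >>=-just-inv {eval k α′ (fst r) x} {λ a → eval k α′ (snd r) x >>= λ b → just (pair a b)} eq
      ... | u , e₁ , e₂ with >>=-just-inv {eval k α′ (snd r) x} {λ b → just (pair u b)} e₂
      ... | w , e₃ , refl =
        ⟶*-step (step-eval e x K p q) ▸ eval⇒⟶* k (fst r) refl e₁ _ ▸
        ⟶*-step (step-pairˡ u (snd r) x K) ▸ eval⇒⟶* k (snd r) refl e₃ _ ▸
        ⟶*-step (trans (step-pairʳ w u K) (cong (λ v → returnState v K) (pr≡pair u w)))
      run⇒⟶* k 8 r e p q x eq K with recur-prefix k (fst r) (snd r) (fst x) (snd x) 0 (+-identityʳ (snd x)) eq
      ... | _ , e₀ =
        ⟶*-step (step-eval e x K p q) ▸ eval⇒⟶* k (fst r) refl e₀ _ ▸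
        recur⇒⟶* k (fst r) (snd r) (fst x) (snd x) 0 (+-identityʳ (snd x)) e₀ eq K
      run⇒⟶* k 9 r e p q x eq K = ⟶*-step (step-eval e x K p q) ▸ search⇒⟶* k r x 0 k eq K

      recur⇒⟶* : ∀ k F G a j i {n h v} → j + i ≡ n →
                  recur k α′ F G a i ≡ just h → recur k α′ F G a n ≡ just v →
                  ∀ K → returnState h (push (pr 3 (pr G (pr a (pr j i)))) K) ⟶* returnState v K
      recur⇒⟶* k F G a zero i refl eh ev K rewrite just-injective (trans (sym eh) ev) =
        ⟶*-step (step-rec _ G a 0 i K)
      recur⇒⟶* k F G a (suc j) i {h = h} refl eh ev K with recur-prefix k F G a j (suc i) (+-suc j i) ev
      ... | _ , e₁ with >>=-just-inv {recur k α′ F G a i} {λ h → eval k α′ G (pair a (pair i h))} e₁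
      ... | _ , e₂ , e₃ with just-injective (trans (sym e₂) eh)
      ... | refl =
        ⟶*-step (step-rec h G a (suc j) i K) ▸ eval⇒⟶* k G (pr²≡pair² a i h) e₃ _ ▸
        recur⇒⟶* k F G a j (suc i) (+-suc j i) e₁ ev K

      search⇒⟶* : ∀ k c x n b {v} → search k α′ c x n b ≡ just v → ∀ K →
                   evalState c (pr x n) (push (pr 4 (pr c (pr x n))) K) ⟶* returnState v K
      search⇒⟶* k c x n (suc b) eq K with >>=-just-inv {eval k α′ c (pair x n)} {searchStep k α′ c x n b} eq
      ... | zero  , e₁ , refl =
        eval⇒⟶* k c (pr≡pair x n) e₁ _ ▸ ⟶*-step (step-min 0 c x n K)
      ... | suc u , e₁ , e₂ =
        eval⇒⟶* k c (pr≡pair x n) e₁ _ ▸ ⟶*-step (step-min (suc u) c x n K) ▸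
        search⇒⟶* k c x (suc n) b e₂ K

  -- On input n, search for the least number j of machine steps after which the
  -- computation started in initE has halted, and output its value.
  module Universal (E A : Exp) where
    initE iterE runningE runningAfterE outputE : Exp
    initE         = evalStateE E A Z
    iterE         = R I (stepE ∘E Snd ∘E Snd)
    runningE      = If Fst (lit 1) (If (Snd ∘E Snd) Z (lit 1))
    runningAfterE = runningE ∘E iterE
    outputE       = Fst ∘E Snd ∘E iterE

    code : ℕ
    code = cComp (compile outputE) (cComp (cPair cId (cMin (compile runningAfterE))) (compile initE))

    module _ (X : Baire) where
      ⟦iter⟧ : ∀ s j → ⟦ iterE ⟧ X (pair s j) ≡ steps X j s
      ⟦iter⟧ s j rewrite fst-pair s j | snd-pair s j = natrec-steps j
        where
        natrec-steps : ∀ j → natrec (λ y → y) (λ y → step X (snd (snd y))) s j ≡ steps X j s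
        natrec-steps zero    = refl
        natrec-steps (suc j) rewrite snd-pr s (pr j (natrec (λ y → y) (λ y → step X (snd (snd y))) s j))
          | snd-pr j (natrec (λ y → y) (λ y → step X (snd (snd y))) s j) = cong (step X) (natrec-steps j)

      running : ℕ → ℕ
      running = ⟦ runningE ⟧ X

      running-halted : ∀ v → running (returnState v 0) ≡ 0
      running-halted v rewrite fst-pr 1 (pr v 0) | snd-pr 1 (pr v 0) | snd-pr v 0 = refl

      stopped⇒fixed : ∀ s → running s ≡ 0 → step X s ≡ s
      stopped⇒fixed s stop with fst s | snd (snd s)
      ... | zero  | _     = ⊥-elim (1+n≢0 stop)
      ... | suc _ | zero  = refl
      ... | suc _ | suc _ = ⊥-elim (1+n≢0 stop)

      steps-fixed : ∀ s → step X s ≡ s → ∀ n → steps X n s ≡ s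
      steps-fixed s fix zero    = refl
      steps-fixed s fix (suc n) = trans (cong (step X) (steps-fixed s fix n)) fix

      stopped⇒halted : ∀ s j m v → running (steps X j s) ≡ 0 → steps X m s ≡ returnState v 0 →
                       steps X j s ≡ returnState v 0
      stopped⇒halted s j m v stop halt with ≤-total j m
      ... | inj₁ j≤m = begin
        steps X j s                   ≡⟨ steps-fixed _ (stopped⇒fixed _ stop) (m ∸ j) ⟨
        steps X (m ∸ j) (steps X j s) ≡⟨ steps-+ X (m ∸ j) j s ⟨
        steps X (m ∸ j + j) s         ≡⟨ cong (λ i → steps X i s) (m∸n+n≡m j≤m) ⟩
        steps X m s                   ≡⟨ halt ⟩
        returnState v 0               ∎
        where open ≡-Reasoning
      ... | inj₂ m≤j = begin
        steps X j s                   ≡⟨ cong (λ i → steps X i s) (m∸n+n≡m m≤j) ⟨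
        steps X (j ∸ m + m) s         ≡⟨ steps-+ X (j ∸ m) m s ⟩
        steps X (j ∸ m) (steps X m s) ≡⟨ cong (steps X (j ∸ m)) halt ⟩
        steps X (j ∸ m) (returnState v 0) ≡⟨ steps-fixed _ (step-halted X v) (j ∸ m) ⟩
        returnState v 0               ∎
        where open ≡-Reasoning

      code⇓ : ∀ n {v} → (∃ λ k → eval k (α′ X) (⟦ E ⟧ X n) (⟦ A ⟧ X n) ≡ just v) → code ⇓[ X ] n ↦ v
      code⇓ n {v} (k , ev) with eval⇒⟶* X k (⟦ E ⟧ X n) refl ev 0
      ... | m , halt with cMin⇓ (λ j → ⟦ runningAfterE ⟧ X (pair s₀ j)) m
                                (λ j → compile-correct runningAfterE X (pair s₀ j))
                                (trans (cong running (trans (⟦iter⟧ s₀ m) halt)) (running-halted v))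
        where s₀ = ⟦ initE ⟧ X n
      ... | j , stop , min⇓ = cComp⇓ (cComp⇓ (compile-correct initE X n) (cPair⇓ (cId⇓ s₀) min⇓))
                                     (⇓-resp output≡v (compile-correct outputE X (pair s₀ j)))
        where
        s₀ = ⟦ initE ⟧ X n
        halted : steps X j s₀ ≡ returnState v 0
        halted = stopped⇒halted s₀ j m v (trans (cong running (sym (⟦iter⟧ s₀ j))) stop) halt
        output≡v : ⟦ outputE ⟧ X (pair s₀ j) ≡ v
        output≡v = begin
          fst (snd (⟦ iterE ⟧ X (pair s₀ j))) ≡⟨ cong (λ s → fst (snd s)) (trans (⟦iter⟧ s₀ j) halted) ⟩
          fst (snd (returnState v 0))         ≡⟨ cong fst (snd-pr 1 (pr v 0)) ⟩
          fst (pr v 0)                        ≡⟨ fst-pr v 0 ⟩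
          v                                   ∎
          where open ≡-Reasoning

universal : Exp → Exp → Exp → ℕ
universal = Machine.Universal.code

universal⇓ : ∀ T E A X n {e x v β} → (λ m → X (⟦ T ⟧ X m)) ≗ β → ⟦ E ⟧ X n ≡ e → ⟦ A ⟧ X n ≡ x →
             e ⇓[ β ] x ↦ v → universal T E A ⇓[ X ] n ↦ v
universal⇓ T E A X n oracle≗β refl refl (k , ev) =
  Machine.Universal.code⇓ T E A X n (k , trans (eval-ext k oracle≗β _ _) ev)

mutual
  ⟨,⟩-even : ∀ p q n → ⟨ p , q ⟩ (n + n) ≡ p n
  ⟨,⟩-even p q zero    = refl
  ⟨,⟩-even p q (suc n) rewrite +-suc n n = ⟨,⟩-odd q (λ m → p (suc m)) n

  ⟨,⟩-odd : ∀ p q n → ⟨ p , q ⟩ (suc (n + n)) ≡ q n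
  ⟨,⟩-odd p q n = ⟨,⟩-even q (λ m → p (suc m)) n

even⊎odd : ∀ n → ∃ λ m → (n ≡ m + m) ⊎ (n ≡ suc (m + m))
even⊎odd zero = 0 , inj₁ refl
even⊎odd (suc n) with even⊎odd n
... | m , inj₁ refl = m , inj₂ refl
... | m , inj₂ refl = suc m , inj₁ (cong suc (sym (+-suc m m)))

left-⟨,⟩ : ∀ p q → left ⟨ p , q ⟩ ≗ p
left-⟨,⟩ = ⟨,⟩-even

right-⟨,⟩ : ∀ p q → right ⟨ p , q ⟩ ≗ q
right-⟨,⟩ = ⟨,⟩-odd

⟨,⟩-cong : ∀ {p p′ q q′} → p ≗ p′ → q ≗ q′ → ⟨ p , q ⟩ ≗ ⟨ p′ , q′ ⟩
⟨,⟩-cong {p} {p′} {q} {q′} p≗p′ q≗q′ n with even⊎odd n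
... | m , inj₁ refl = trans (⟨,⟩-even p q m) (trans (p≗p′ m) (sym (⟨,⟩-even p′ q′ m)))
... | m , inj₂ refl = trans (⟨,⟩-odd p q m) (trans (q≗q′ m) (sym (⟨,⟩-odd p′ q′ m)))

⟨left,right⟩ : ∀ z → ⟨ left z , right z ⟩ ≗ z
⟨left,right⟩ z n with even⊎odd n
... | m , inj₁ refl = ⟨,⟩-even (left z) (right z) m
... | m , inj₂ refl = ⟨,⟩-odd (left z) (right z) m

left-cong : ∀ {u v : Baire} → u ≗ v → left u ≗ left v
left-cong u≗v n = u≗v (n + n)

right-cong : ∀ {u v : Baire} → u ≗ v → right u ≗ right v
right-cong u≗v n = u≗v (suc (n + n))

≗-refl : ∀ {u : Baire} → u ≗ u
≗-refl _ = refl

≗-sym : ∀ {u v : Baire} → u ≗ v → v ≗ u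
≗-sym u≗v n = sym (u≗v n)

≗-trans : ∀ {u v w : Baire} → u ≗ v → v ≗ w → u ≗ w
≗-trans u≗v v≗w n = trans (u≗v n) (v≗w n)

↦-oracle-ext : ∀ {e α β y} → α ≗ β → e ⟦ α ⟧↦ y → e ⟦ β ⟧↦ y
↦-oracle-ext {e} α≗β e↦y n = ⇓-oracle-ext {e = e} α≗β (e↦y n)

↦-det : ∀ {e α y y′} → e ⟦ α ⟧↦ y → e ⟦ α ⟧↦ y′ → y ≗ y′
↦-det e↦y e↦y′ n = ⇓-det (e↦y n) (e↦y′ n)

-- halfParityE n = pr ⌊n/2⌋ (n mod 2), by recursion on n.
halfParityStepE halfParityE halfE parityE doubleE : Exp
halfParityStepE = If (Snd ∘E Snd ∘E Snd) ⟪ Fst ∘E Snd ∘E Snd , S ∘E Z ⟫ ⟪ S ∘E Fst ∘E Snd ∘E Snd , Z ⟫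
halfParityE     = R ⟪ Z , Z ⟫ halfParityStepE ∘E ⟪ Z , I ⟫
halfE           = Fst ∘E halfParityE
parityE         = Snd ∘E halfParityE
doubleE         = R Z (S ∘E S ∘E Snd ∘E Snd) ∘E ⟪ Z , I ⟫

module _ (α : Baire) where
  private
    halfParity : ℕ → ℕ
    halfParity = natrec (λ _ → pr 0 0) (⟦ halfParityStepE ⟧ α) 0

    ⟦halfParity⟧ : ∀ n → ⟦ halfParityE ⟧ α n ≡ halfParity n
    ⟦halfParity⟧ n rewrite fst-pr 0 n | snd-pr 0 n = refl

    halfParity-even : ∀ m → halfParity (m + m) ≡ pr m 0
    halfParity-odd  : ∀ m → halfParity (suc (m + m)) ≡ pr m 1
    halfParity-even zero    = refl
    halfParity-even (suc m) rewrite +-suc m m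
      | snd-pr 0 (pr (suc (m + m)) (halfParity (suc (m + m))))
      | snd-pr (suc (m + m)) (halfParity (suc (m + m)))
      | halfParity-odd m | fst-pr m 1 | snd-pr m 1 = refl
    halfParity-odd m rewrite snd-pr 0 (pr (m + m) (halfParity (m + m))) | snd-pr (m + m) (halfParity (m + m))
      | halfParity-even m | fst-pr m 0 | snd-pr m 0 = refl

  ⟦half⟧-even : ∀ m → ⟦ halfE ⟧ α (m + m) ≡ m
  ⟦half⟧-even m rewrite ⟦halfParity⟧ (m + m) | halfParity-even m = fst-pr m 0

  ⟦half⟧-odd : ∀ m → ⟦ halfE ⟧ α (suc (m + m)) ≡ m
  ⟦half⟧-odd m rewrite ⟦halfParity⟧ (suc (m + m)) | halfParity-odd m = fst-pr m 1

  ⟦parity⟧-even : ∀ m → ⟦ parityE ⟧ α (m + m) ≡ 0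
  ⟦parity⟧-even m rewrite ⟦halfParity⟧ (m + m) | halfParity-even m = snd-pr m 0

  ⟦parity⟧-odd : ∀ m → ⟦ parityE ⟧ α (suc (m + m)) ≡ 1
  ⟦parity⟧-odd m rewrite ⟦halfParity⟧ (suc (m + m)) | halfParity-odd m = snd-pr m 1

  ⟦double⟧ : ∀ n → ⟦ doubleE ⟧ α n ≡ n + n
  ⟦double⟧ n rewrite fst-pr 0 n | snd-pr 0 n = natrec-double n
    where
    natrec-double : ∀ n → natrec (λ _ → 0) (⟦ S ∘E S ∘E Snd ∘E Snd ⟧ α) 0 n ≡ n + n
    natrec-double zero    = refl
    natrec-double (suc n) rewrite snd-pr 0 (pr n (natrec (λ _ → 0) (⟦ S ∘E S ∘E Snd ∘E Snd ⟧ α) 0 n))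
      | snd-pr n (natrec (λ _ → 0) (⟦ S ∘E S ∘E Snd ∘E Snd ⟧ α) 0 n) | natrec-double n | +-suc n n = refl

pqIndexE qrIndexE pqrIndexE reassocIndexE : Exp
pqIndexE      = If parityE (doubleE ∘E S ∘E S ∘E halfE) I
qrIndexE      = If parityE (doubleE ∘E S ∘E doubleE ∘E halfE) I
pqrIndexE     = If parityE (doubleE ∘E doubleE ∘E S ∘E S ∘E halfE) (qrIndexE ∘E halfE)
reassocIndexE = If parityE (If (parityE ∘E halfE) halfE (S ∘E doubleE ∘E doubleE ∘E halfE ∘E halfE))
                           (S ∘E doubleE)

pqIndexE-correct : ∀ x → (λ m → x (⟦ pqIndexE ⟧ x m)) ≗ ⟨ qArg (left x) , right x ⟩
pqIndexE-correct x m with even⊎odd m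
... | j , inj₁ refl rewrite ⟦parity⟧-even x j | ⟦half⟧-even x j | ⟦double⟧ x (suc (suc j)) =
  sym (⟨,⟩-even (qArg (left x)) (right x) j)
... | j , inj₂ refl rewrite ⟦parity⟧-odd x j = sym (⟨,⟩-odd (qArg (left x)) (right x) j)

qrIndexE-correct : ∀ x z m → ⟨ x , z ⟩ (⟦ qrIndexE ⟧ ⟨ x , z ⟩ m) ≡ ⟨ right x , z ⟩ m
qrIndexE-correct x z m with even⊎odd m
... | t , inj₁ refl rewrite ⟦parity⟧-even ⟨ x , z ⟩ t | ⟦half⟧-even ⟨ x , z ⟩ t | ⟦double⟧ ⟨ x , z ⟩ t
  | ⟦double⟧ ⟨ x , z ⟩ (suc (t + t)) | ⟨,⟩-even x z (suc (t + t)) | ⟨,⟩-even (right x) z t = refl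
... | t , inj₂ refl rewrite ⟦parity⟧-odd ⟨ x , z ⟩ t | ⟨,⟩-odd x z t | ⟨,⟩-odd (right x) z t = refl

pqrIndexE-correct : ∀ x z →
  (λ k → ⟨ x , z ⟩ (⟦ pqrIndexE ⟧ ⟨ x , z ⟩ k)) ≗ ⟨ qArg (left x) , ⟨ right x , z ⟩ ⟩
pqrIndexE-correct x z k with even⊎odd k
... | j , inj₁ refl rewrite ⟦parity⟧-even ⟨ x , z ⟩ j | ⟦half⟧-even ⟨ x , z ⟩ j | ⟦double⟧ ⟨ x , z ⟩ (suc (suc j))
  | ⟦double⟧ ⟨ x , z ⟩ (suc (suc j) + suc (suc j)) | ⟨,⟩-even x z (suc (suc j) + suc (suc j))
  | ⟨,⟩-even (qArg (left x)) ⟨ right x , z ⟩ j = refl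
... | j , inj₂ refl rewrite ⟦parity⟧-odd ⟨ x , z ⟩ j | ⟦half⟧-odd ⟨ x , z ⟩ j
  | ⟨,⟩-odd (qArg (left x)) ⟨ right x , z ⟩ j = qrIndexE-correct x z j

reassocIndexE-correct : ∀ Y p q r → Y ≗ ⟨ p , ⟨ q , r ⟩ ⟩ →
  (λ k → Y (⟦ reassocIndexE ⟧ Y k)) ≗ ⟨ ⟨ p , q ⟩ , r ⟩
reassocIndexE-correct Y p q r Y≗ k with even⊎odd k
... | j , inj₂ refl rewrite ⟦parity⟧-odd Y j | ⟦double⟧ Y (suc (j + j)) | Y≗ (suc (suc (j + j) + suc (j + j)))
  | ⟨,⟩-odd p ⟨ q , r ⟩ (suc (j + j)) | ⟨,⟩-odd q r j | ⟨,⟩-odd ⟨ p , q ⟩ r j = refl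
... | j , inj₁ refl with even⊎odd j
...   | s , inj₁ refl rewrite ⟦parity⟧-even Y (s + s) | ⟦half⟧-even Y (s + s) | ⟦parity⟧-even Y s | Y≗ (s + s)
  | ⟨,⟩-even p ⟨ q , r ⟩ s | ⟨,⟩-even ⟨ p , q ⟩ r (s + s) | ⟨,⟩-even p q s = refl
...   | s , inj₂ refl rewrite ⟦parity⟧-even Y (suc (s + s)) | ⟦half⟧-even Y (suc (s + s)) | ⟦parity⟧-odd Y s
  | ⟦half⟧-odd Y s | ⟦double⟧ Y s | ⟦double⟧ Y (s + s) | Y≗ (suc ((s + s) + (s + s)))
  | ⟨,⟩-odd p ⟨ q , r ⟩ (s + s) | ⟨,⟩-even q r s | ⟨,⟩-even ⟨ p , q ⟩ r (suc (s + s)) | ⟨,⟩-odd p q s = refl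

-- Unlike compile (If C A B), this runs only the selected branch, so B may be partial.
parityCase : Exp → ℕ → ℕ
parityCase A B = cComp (cRec (compile A) (cComp B cFst)) (cPair cId (compile parityE))

parityCase-even : ∀ {α} A B j → parityCase A B ⇓[ α ] j + j ↦ ⟦ A ⟧ α (j + j)
parityCase-even {α} A B j =
  cComp⇓ (⇓-resp (cong (pair (j + j)) (⟦parity⟧-even α j)) (cPair⇓ (cId⇓ _) (compile-correct parityE α _)))
         (cRec⇓-depth0 (compile-correct A α _))

parityCase-odd : ∀ {α} A B j {v} → B ⇓[ α ] suc (j + j) ↦ v → parityCase A B ⇓[ α ] suc (j + j) ↦ v
parityCase-odd {α} A B j {v} B⇓v =
  cComp⇓ (⇓-resp (cong (pair (suc (j + j))) (⟦parity⟧-odd α j)) (cPair⇓ (cId⇓ _) (compile-correct parityE α _)))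
         (cRec⇓-depth1 (compile-correct A α (suc (j + j)))
                       (cComp⇓ (cFst⇓ _) (subst (λ n → B ⇓[ α ] n ↦ v) (sym (fst-pair (suc (j + j)) _)) B⇓v)))

-- Opaque, so that unification never unfolds the universal codes.
opaque
  -- For x = ⟨ (e , i , p) , q ⟩ and r, these run Φₑ(p,q) and Φᵢ(p,q,r).
  runΦₑ runΦᵢ : ℕ
  runΦₑ = universal pqIndexE (O ∘E Z) I
  runΦᵢ = universal pqrIndexE (O ∘E lit 4) halfE

  runΦₑ-correct : ∀ x {y} → qIdx₁ (left x) ⟦ ⟨ qArg (left x) , right x ⟩ ⟧↦ y → runΦₑ ⟦ x ⟧↦ y
  runΦₑ-correct x Φₑ↦y n = universal⇓ pqIndexE (O ∘E Z) I x n (pqIndexE-correct x) refl refl (Φₑ↦y n)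

  quotientSolution : ℕ
  quotientSolution = parityCase (O ∘E qrIndexE ∘E halfE) runΦᵢ

  quotientSolution-correct : ∀ x r {b} → qIdx₂ (left x) ⟦ ⟨ qArg (left x) , ⟨ right x , r ⟩ ⟩ ⟧↦ b →
                             quotientSolution ⟦ ⟨ x , r ⟩ ⟧↦ ⟨ ⟨ right x , r ⟩ , b ⟩
  quotientSolution-correct x r {b} Φᵢ↦b n with even⊎odd n
  ... | j , inj₁ refl = ⇓-resp qr≡ (parityCase-even (O ∘E qrIndexE ∘E halfE) runΦᵢ j)
    where
    qr≡ : ⟦ O ∘E qrIndexE ∘E halfE ⟧ ⟨ x , r ⟩ (j + j) ≡ ⟨ ⟨ right x , r ⟩ , b ⟩ (j + j)
    qr≡ rewrite ⟦half⟧-even ⟨ x , r ⟩ j = trans (qrIndexE-correct x r j) (sym (⟨,⟩-even ⟨ right x , r ⟩ b j))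
  ... | j , inj₂ refl = ⇓-resp (sym (⟨,⟩-odd ⟨ right x , r ⟩ b j))
    (parityCase-odd (O ∘E qrIndexE ∘E halfE) runΦᵢ j
    (universal⇓ pqrIndexE (O ∘E lit 4) halfE ⟨ x , r ⟩ (suc (j + j))
                (pqrIndexE-correct x r) (⟨,⟩-even x r 2) (⟦half⟧-odd ⟨ x , r ⟩ j) (Φᵢ↦b j)))

  rightΦ leftΦ : ℕ → ℕ
  rightΦ b = universal reassocIndexE (lit b) (S ∘E doubleE)
  leftΦ  b = universal reassocIndexE (lit b) doubleE

  rightΦ-correct : ∀ b x q r {w} → b ⟦ ⟨ ⟨ x , q ⟩ , r ⟩ ⟧↦ w → rightΦ b ⟦ ⟨ x , ⟨ q , r ⟩ ⟩ ⟧↦ right w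
  rightΦ-correct b x q r b↦w n =
    universal⇓ reassocIndexE (lit b) (S ∘E doubleE) ⟨ x , ⟨ q , r ⟩ ⟩ n
               (reassocIndexE-correct _ x q r ≗-refl) (⟦lit⟧ b ⟨ x , ⟨ q , r ⟩ ⟩ n)
               (cong suc (⟦double⟧ ⟨ x , ⟨ q , r ⟩ ⟩ n)) (b↦w (suc (n + n)))

  leftΦ-correct : ∀ b x z {w} → b ⟦ ⟨ ⟨ x , left z ⟩ , right z ⟩ ⟧↦ w → leftΦ b ⟦ ⟨ x , z ⟩ ⟧↦ left w
  leftΦ-correct b x z b↦w n =
    universal⇓ reassocIndexE (lit b) doubleE ⟨ x , z ⟩ n
               (reassocIndexE-correct _ x (left z) (right z) (⟨,⟩-cong ≗-refl (≗-sym (⟨left,right⟩ z))))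
               (⟦lit⟧ b ⟨ x , z ⟩ n) (⟦double⟧ ⟨ x , z ⟩ n) (b↦w (n + n))

-- The f/g-instance (a , rightΦ b , x).
quotientInstanceE : ℕ → ℕ → Exp
quotientInstanceE a b = If I (lit a) (If Pred (lit (rightΦ b)) (O ∘E Pred ∘E Pred))

dom-resp : ∀ {f} → Extensional f → ∀ {x x′} → x ≗ x′ → dom f x → dom f x′
dom-resp (dom-ext , _) = dom-ext _ _

val-resp : ∀ {f} → Extensional f → ∀ {x x′ y y′} → x ≗ x′ → y ≗ y′ → val f x y → val f x′ y′
val-resp (_ , val-ext) = val-ext _ _ _ _

module _ (f g : Problem) (ef : Extensional f) (eg : Extensional g) where

  quotient-isMultiFunction : (∃ λ q → dom g q) → IsMultiFunction f → IsMultiFunction (f /W g)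
  quotient-isMultiFunction (q , dq) mf x dx with dx q dq
  ... | (a , Φₑ↦a , da) , _ with mf a da
  ... | r , r∈fa =
    ⟨ q , r ⟩ , dom-resp eg (≗-sym (left-⟨,⟩ q r)) dq ,
    a , ↦-oracle-ext (⟨,⟩-cong ≗-refl (≗-sym (left-⟨,⟩ q r))) Φₑ↦a ,
    val-resp ef ≗-refl (≗-sym (right-⟨,⟩ q r)) r∈fa

  quotient⊠≤W : ((f /W g) ⊠ g) ≤W f
  quotient⊠≤W = runΦₑ , quotientSolution , λ x dx → forward x dx , backward x dx
    where
    forward : ∀ x → dom ((f /W g) ⊠ g) x → ∃ λ y → (runΦₑ ⟦ x ⟧↦ y) × dom f y
    forward x (dq , dg) with dq (right x) dg
    ... | (y , Φₑ↦y , dy) , _ = y , runΦₑ-correct x Φₑ↦y , dy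

    backward : ∀ x → dom ((f /W g) ⊠ g) x → ∀ y → runΦₑ ⟦ x ⟧↦ y → ∀ r → val f y r →
               ∃ λ w → (quotientSolution ⟦ ⟨ x , r ⟩ ⟧↦ w) × val ((f /W g) ⊠ g) x w
    backward x (dq , dg) y run↦y r r∈fy with dq (right x) dg
    ... | (y₀ , Φₑ↦y₀ , _) , solve = solution (solve y₀ Φₑ↦y₀ r r∈fy₀)
      where
      q = right x

      r∈fy₀ : val f y₀ r
      r∈fy₀ = val-resp ef (↦-det run↦y (runΦₑ-correct x Φₑ↦y₀)) ≗-refl r∈fy

      solution : (∃ λ b → (qIdx₂ (left x) ⟦ ⟨ qArg (left x) , ⟨ q , r ⟩ ⟩ ⟧↦ b) × val g q b) →
                 ∃ λ w → (quotientSolution ⟦ ⟨ x , r ⟩ ⟧↦ w) × val ((f /W g) ⊠ g) x w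
      solution (b , Φᵢ↦b , b∈gq) =
        ⟨ ⟨ q , r ⟩ , b ⟩ , quotientSolution-correct x r Φᵢ↦b ,
        (dom-resp eg (≗-sym left²) dg ,
         y₀ , ↦-oracle-ext (⟨,⟩-cong ≗-refl (≗-sym left²)) Φₑ↦y₀ ,
         val-resp ef ≗-refl (≗-sym right-left) r∈fy₀) ,
        val-resp eg ≗-refl (≗-sym (right-⟨,⟩ ⟨ q , r ⟩ b)) b∈gq
        where
        left² : left (left ⟨ ⟨ q , r ⟩ , b ⟩) ≗ q
        left² = ≗-trans (left-cong (left-⟨,⟩ ⟨ q , r ⟩ b)) (left-⟨,⟩ q r)
        right-left : right (left ⟨ ⟨ q , r ⟩ , b ⟩) ≗ r
        right-left = ≗-trans (right-cong (left-⟨,⟩ ⟨ q , r ⟩ b)) (right-⟨,⟩ q r)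

module _ (f g h : Problem) (eg : Extensional g) (eh : Extensional h) where

  ⊠-dom : ∀ {x q} → dom h x → dom g q → dom (h ⊠ g) ⟨ x , q ⟩
  ⊠-dom {x} {q} dx dq = dom-resp eh (≗-sym (left-⟨,⟩ x q)) dx , dom-resp eg (≗-sym (right-⟨,⟩ x q)) dq

  ⊠≤W⇒≤W-quotient : (h ⊠ g) ≤W f → h ≤W (f /W g)
  ⊠≤W⇒≤W-quotient (a , b , red) =
    compile (quotientInstanceE a b) , leftΦ b , λ x dx → forward x dx , backward x dx
    where
    inst : Baire → Baire
    inst = ⟦ quotientInstanceE a b ⟧

    inst↦ : ∀ x → compile (quotientInstanceE a b) ⟦ x ⟧↦ inst x
    inst↦ = compile-correct (quotientInstanceE a b)

    forward : ∀ x → dom h x → ∃ λ y → (compile (quotientInstanceE a b) ⟦ x ⟧↦ y) × dom (f /W g) y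
    forward x dx = inst x , inst↦ x , λ q dq → Φₑ-defined q dq , Φᵢ-solves q dq
      where
      Φₑ-defined : ∀ q → dom g q → ∃ λ y → (qIdx₁ (inst x) ⟦ ⟨ x , q ⟩ ⟧↦ y) × dom f y
      Φₑ-defined q dq with proj₁ (red ⟨ x , q ⟩ (⊠-dom dx dq))
      ... | y , a↦y , dy = y , subst (λ e → e ⟦ ⟨ x , q ⟩ ⟧↦ y) (sym (⟦lit⟧ a x 0)) a↦y , dy

      Φᵢ-solves : ∀ q → dom g q → ∀ y → qIdx₁ (inst x) ⟦ ⟨ x , q ⟩ ⟧↦ y → ∀ r → val f y r →
                  ∃ λ c → (qIdx₂ (inst x) ⟦ ⟨ x , ⟨ q , r ⟩ ⟩ ⟧↦ c) × val g q c
      Φᵢ-solves q dq y Φₑ↦y r r∈fy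
        with proj₂ (red ⟨ x , q ⟩ (⊠-dom dx dq)) y
                   (subst (λ e → e ⟦ ⟨ x , q ⟩ ⟧↦ y) (⟦lit⟧ a x 0) Φₑ↦y) r r∈fy
      ... | w , b↦w , _ , right-w∈g =
        right w ,
        subst (λ e → e ⟦ ⟨ x , ⟨ q , r ⟩ ⟩ ⟧↦ right w) (sym (⟦lit⟧ (rightΦ b) x 1)) (rightΦ-correct b x q r b↦w) ,
        val-resp eg (right-⟨,⟩ x q) ≗-refl right-w∈g

    backward : ∀ x → dom h x → ∀ y → compile (quotientInstanceE a b) ⟦ x ⟧↦ y → ∀ z → val (f /W g) y z →
               ∃ λ w → (leftΦ b ⟦ ⟨ x , z ⟩ ⟧↦ w) × val h x w
    backward x dx y ↦y z (dgz , c , Φₑ↦c , c∈f) =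
      solution (proj₂ (red ⟨ x , left z ⟩ (⊠-dom dx dgz)) c a↦c (right z) c∈f)
      where
      y≗inst : y ≗ inst x
      y≗inst = ↦-det ↦y (inst↦ x)

      a↦c : a ⟦ ⟨ x , left z ⟩ ⟧↦ c
      a↦c = subst (λ e → e ⟦ ⟨ x , left z ⟩ ⟧↦ c) (trans (y≗inst 0) (⟦lit⟧ a x 0))
                  (↦-oracle-ext (⟨,⟩-cong (λ n → y≗inst (suc (suc n))) ≗-refl) Φₑ↦c)

      solution : (∃ λ w → (b ⟦ ⟨ ⟨ x , left z ⟩ , right z ⟩ ⟧↦ w) × val (h ⊠ g) ⟨ x , left z ⟩ w) →
                 ∃ λ w → (leftΦ b ⟦ ⟨ x , z ⟩ ⟧↦ w) × val h x w
      solution (w , b↦w , left-w∈h , _) =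
        left w , leftΦ-correct b x z b↦w , val-resp eh (left-⟨,⟩ x (left z)) ≗-refl left-w∈h

proposition9p2 : (f g : Problem) → IsMultiFunction f → IsMultiFunction g →
                   Extensional f → Extensional g → (∃ λ q → dom g q) →
                   (IsMultiFunction (f /W g) × ((f /W g) ⊠ g) ≤W f) ×
                   (∀ h → IsMultiFunction h → Extensional h → (h ⊠ g) ≤W f → h ≤W (f /W g))
proposition9p2 f g mf _ ef eg dom-g≢∅ =
  (quotient-isMultiFunction f g ef eg dom-g≢∅ mf , quotient⊠≤W f g ef eg) ,
  λ h _ eh → ⊠≤W⇒≤W-quotient f g h eg eh
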